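{- Let $k,n$ be integers with $3\le k\le n$ and let $G$ be a graph of order $n$. Then $0\le \tau_k(G)\le n-k$.
   Context: All graphs are finite, simple and undirected. For $S\subseteq V(G)$ with $|S|\ge 2$, a pedant $S$-Steiner tree is a subgraph of $G$ that is a tree containing $S$ in which every vertex of $S$ has degree exactly one. Two pedant $S$-Steiner trees $T,T'$ are internally disjoint if $E(T)\cap E(T')=\emptyset$ and $V(T)\cap V(T')=S$. $\tau_G(S)$ is the maximum number of pairwise internally disjoint pedant $S$-Steiner trees in $G$, and for $2\le k\le n$, $\tau_k(G)=\min\{\tau_G(S): S\subseteq V(G),\ |S|=k\}$; by convention $\tau_k(G)=0$ when $G$ is disconnected. -}

module Defs where

open import Data.Nat using (ℕ; zero; suc; _≤_)
open import Data.Fin using (Fin; zero; suc; inject₁; fromℕ)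
open import Data.Fin.Subset using (Subset; _∈_; _∉_; ∣_∣)
open import Data.Product using (Σ; _×_; ∃)
open import Relation.Binary.PropositionalEquality using (_≡_; _≢_)
open import Relation.Binary.Construct.Closure.ReflexiveTransitive using (Star)
open import Relation.Nullary using (¬_)
open import Function.Definitions using (Injective)

record Graph (n : ℕ) : Set where
  field
    adj   : Fin n → Subset n
    sym   : ∀ {u v} → v ∈ adj u → u ∈ adj v
    irrefl : ∀ {v} → v ∉ adj v
open Graph public

Connected : ∀ {n} → Graph n → Set
Connected {n} G = (u v : Fin n) → Star (λ a b → b ∈ adj G a) u v

record Subgraph {n : ℕ} (G : Graph n) : Set where
  field
    V      : Subset n
    E      : Fin n → Subset n
    E-sym  : ∀ {u v} → v ∈ E u → u ∈ E v
    E⊆G    : ∀ {u v} → v ∈ E u → v ∈ adj G u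
    E⊆V    : ∀ {u v} → v ∈ E u → u ∈ V
open Subgraph public

SubConnected : ∀ {n} {G : Graph n} → Subgraph G → Set
SubConnected {n} T = ∀ {u v : Fin n} → u ∈ V T → v ∈ V T → Star (λ a b → b ∈ E T a) u v

-- a cycle in the subgraph: m+3 distinct vertices c 0, ..., c (m+2),
-- consecutive ones adjacent, and c (m+2) adjacent to c 0.
HasCycle : ∀ {n} {G : Graph n} → Subgraph G → Set
HasCycle {n} T =
  Σ ℕ λ m → Σ (Fin (suc (suc (suc m))) → Fin n) λ c →
    Injective _≡_ _≡_ c ×
    ((i : Fin (suc (suc m))) → c (suc i) ∈ E T (c (inject₁ i))) ×
    (c zero ∈ E T (c (fromℕ (suc (suc m)))))

IsTree : ∀ {n} {G : Graph n} → Subgraph G → Set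
IsTree T = SubConnected T × ¬ HasCycle T

deg : ∀ {n} {G : Graph n} → Subgraph G → Fin n → ℕ
deg T v = ∣ E T v ∣

IsPedantSteinerTree : ∀ {n} (G : Graph n) → Subset n → Subgraph G → Set
IsPedantSteinerTree {n} G S T =
  IsTree T × (∀ {v : Fin n} → v ∈ S → v ∈ V T) × (∀ {v : Fin n} → v ∈ S → deg T v ≡ 1)

InternallyDisjoint : ∀ {n} {G : Graph n} → Subset n → Subgraph G → Subgraph G → Set
InternallyDisjoint {n} S T T′ =
  (∀ {u v : Fin n} → v ∈ E T u → v ∈ E T′ u → ⊥′) ×
  (∀ {v : Fin n} → v ∈ V T → v ∈ V T′ → v ∈ S) ×
  (∀ {v : Fin n} → v ∈ S → v ∈ V T × v ∈ V T′)
  where open import Data.Empty renaming (⊥ to ⊥′)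

HasFamily : ∀ {n} (G : Graph n) → Subset n → ℕ → Set
HasFamily G S t =
  Σ (Fin t → Subgraph G) λ F →
    (∀ i → IsPedantSteinerTree G S (F i)) ×
    (∀ i j → i ≢ j → InternallyDisjoint S (F i) (F j))

IsTauS : ∀ {n} (G : Graph n) → Subset n → ℕ → Set
IsTauS G S t = HasFamily G S t × (∀ t′ → HasFamily G S t′ → t′ ≤ t)

IsTauK : ∀ {n} (G : Graph n) → ℕ → ℕ → Set
IsTauK {n} G k t =
  (¬ Connected G → t ≡ 0) ×
  (Connected G →
    (Σ (Subset n) λ S → ∣ S ∣ ≡ k × IsTauS G S t) ×
    (∀ (S : Subset n) → ∣ S ∣ ≡ k → ∀ s → IsTauS G S s → t ≤ s))

module Submission where

-- For the upper bound, if G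
-- is disconnected then t = 0; otherwise t = τ_G(S) for some S with |S| = k,
-- so G has t pairwise internally disjoint pedant S-Steiner trees.
--   * A connected graph all of whose vertices have degree one has at most two
--     vertices (every walk from a vertex a alternates between a and its unique
--     neighbour).  Hence, as |S| ≥ 3 and the vertices of S are leaves, every
--     pedant S-Steiner tree contains a vertex outside S.
--   * Choosing such a vertex in each tree of the family gives a map from the
--     trees to the complement of S, injective because two internally disjoint
--     trees share only vertices of S.  So t ≤ |∁ S| = n - k.  Connectedness is not decidable, so the final case split on it is
-- made under a double negation, which is harmless for the decidable goal.

open import Defs
open import Data.Nat using (ℕ; zero; suc; _+_; _∸_; _≤_; z≤n; s≤s; _≤?_)
open import Data.Nat.Properties
  using (≤-trans; ≤-reflexive; ≰⇒>; +-monoʳ-≤; +-suc; n≤1+n; <⇒≱; ≤-<-trans; module ≤-Reasoning)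
open import Data.Bool using (true; false)
open import Data.Vec using (_∷_; [])
open import Data.Fin using (Fin; zero; suc; _≟_)
open import Data.Fin.Properties using (any?; 0≢1+n; suc-injective)
open import Data.Fin.Subset
  using (Subset; _∈_; _∉_; _∪_; _-_; _⊆_; ⁅_⁆; ∁; ∣_∣; Nonempty)
open import Data.Fin.Subset.Properties
  using ( _∈?_; nonempty?; Empty-unique; ∣⊥∣≡0; ∣⁅x⁆∣≡1; p⊆q⇒∣p∣≤∣q∣
        ; x∈⁅x⁆; x∈p∪q⁺; x∈p∧x≢y⇒x∈p-y
        ; x∈p⇒∣p-x∣<∣p∣; x∉p⇒x∈∁p; ∣∁p∣≡n∸∣p∣ )
open import Data.Product using (Σ; _×_; _,_; proj₁; proj₂)
open import Data.Sum using (_⊎_; inj₁; inj₂)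
open import Data.Empty using (⊥-elim)
open import Relation.Binary.PropositionalEquality
  using (_≡_; refl; trans; cong; cong₂; subst)
  renaming (sym to ≡-sym)
open import Relation.Binary.Construct.Closure.ReflexiveTransitive using (Star; ε; _◅_)
open import Relation.Nullary using (yes; no)
open import Relation.Nullary.Decidable using (_×-dec_; ¬?; decidable-stable)
open import Function.Definitions using (Injective)

-- An injection from Fin t into the subset p shows t ≤ |p|: remove the image
-- of zero from p and recurse on the remaining t - 1 points.
injection-bound : ∀ {t n} (p : Subset n) (f : Fin t → Fin n) →
  Injective _≡_ _≡_ f → (∀ i → f i ∈ p) → t ≤ ∣ p ∣
injection-bound {zero}  p f inj f∈p = z≤n
injection-bound {suc t} p f inj f∈p =
  ≤-<-trans (injection-bound (p - f zero) (λ i → f (suc i)) (λ e → suc-injective (inj e)) rest)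
            (x∈p⇒∣p-x∣<∣p∣ (f∈p zero))
  where
  rest : ∀ i → f (suc i) ∈ p - f zero
  rest i = x∈p∧x≢y⇒x∈p-y (f∈p (suc i)) (λ e → 0≢1+n (≡-sym (inj e)))

at-most-one : ∀ {n} (p : Subset n) → ∣ p ∣ ≤ 1 → ∀ {x y} → x ∈ p → y ∈ p → x ≡ y
at-most-one p ∣p∣≤1 {x} {y} x∈p y∈p with x ≟ y
... | yes x≡y = x≡y
... | no  x≢y = ⊥-elim (<⇒≱ (s≤s (s≤s z≤n)) (≤-trans (injection-bound p pair pair-inj pair∈p) ∣p∣≤1))
  where
  pair : Fin 2 → Fin _
  pair zero    = x
  pair (suc _) = y
  pair-inj : Injective _≡_ _≡_ pair
  pair-inj {zero}  {zero}  _ = refl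
  pair-inj {zero}  {suc _} e = ⊥-elim (x≢y e)
  pair-inj {suc _} {zero}  e = ⊥-elim (x≢y (≡-sym e))
  pair-inj {suc zero} {suc zero} _ = refl
  pair∈p : ∀ i → pair i ∈ p
  pair∈p zero    = x∈p
  pair∈p (suc _) = y∈p

nonempty-of-size : ∀ {n} (p : Subset n) → 1 ≤ ∣ p ∣ → Nonempty p
nonempty-of-size {n} p 1≤∣p∣ with nonempty? p
... | yes ne    = ne
... | no  empty = ⊥-elim (<⇒≱ 1≤∣p∣ (≤-reflexive (trans (cong ∣_∣ (Empty-unique empty)) (∣⊥∣≡0 n))))

∣p∪q∣≤∣p∣+∣q∣ : ∀ {n} (p q : Subset n) → ∣ p ∪ q ∣ ≤ ∣ p ∣ + ∣ q ∣
∣p∪q∣≤∣p∣+∣q∣ [] [] = z≤n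
∣p∪q∣≤∣p∣+∣q∣ (true  ∷ p) (true  ∷ q) = s≤s (≤-trans (∣p∪q∣≤∣p∣+∣q∣ p q) (+-monoʳ-≤ ∣ p ∣ (n≤1+n ∣ q ∣)))
∣p∪q∣≤∣p∣+∣q∣ (true  ∷ p) (false ∷ q) = s≤s (∣p∪q∣≤∣p∣+∣q∣ p q)
∣p∪q∣≤∣p∣+∣q∣ (false ∷ p) (true  ∷ q) = subst (suc ∣ p ∪ q ∣ ≤_) (≡-sym (+-suc ∣ p ∣ ∣ q ∣)) (s≤s (∣p∪q∣≤∣p∣+∣q∣ p q))
∣p∪q∣≤∣p∣+∣q∣ (false ∷ p) (false ∷ q) = ∣p∪q∣≤∣p∣+∣q∣ p q

pair-bound : ∀ {n} (p : Subset n) (a b : Fin n) → (∀ {y} → y ∈ p → y ≡ a ⊎ y ≡ b) → ∣ p ∣ ≤ 2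
pair-bound p a b p⊆ab = begin
  ∣ p ∣                 ≤⟨ p⊆q⇒∣p∣≤∣q∣ p⊆⁅a⁆∪⁅b⁆ ⟩
  ∣ ⁅ a ⁆ ∪ ⁅ b ⁆ ∣     ≤⟨ ∣p∪q∣≤∣p∣+∣q∣ ⁅ a ⁆ ⁅ b ⁆ ⟩
  ∣ ⁅ a ⁆ ∣ + ∣ ⁅ b ⁆ ∣ ≡⟨ cong₂ _+_ (∣⁅x⁆∣≡1 a) (∣⁅x⁆∣≡1 b) ⟩
  2                     ∎
  where
  open ≤-Reasoning
  p⊆⁅a⁆∪⁅b⁆ : p ⊆ ⁅ a ⁆ ∪ ⁅ b ⁆
  p⊆⁅a⁆∪⁅b⁆ y∈p with p⊆ab y∈p
  ... | inj₁ refl = x∈p∪q⁺ (inj₁ (x∈⁅x⁆ a))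
  ... | inj₂ refl = x∈p∪q⁺ (inj₂ (x∈⁅x⁆ b))

-- In a connected subgraph in which every vertex has degree one, every vertex
-- is an end of any given edge ab: walks from a alternate between a and b.
module _ {n} {G : Graph n} (T : Subgraph G) (connected : SubConnected T)
         (leaf : ∀ {v} → v ∈ V T → deg T v ≡ 1) where

  sole-neighbour : ∀ {v u w} → v ∈ V T → u ∈ E T v → w ∈ E T v → w ≡ u
  sole-neighbour v∈V u∈Ev w∈Ev = at-most-one (E T _) (≤-reflexive (leaf v∈V)) w∈Ev u∈Ev

  confined-to-edge : ∀ {a b} → a ∈ V T → b ∈ E T a → ∀ {y} → y ∈ V T → y ≡ a ⊎ y ≡ b
  confined-to-edge {a} {b} a∈V b∈Ea y∈V = alternate (inj₁ refl) (connected a∈V y∈V)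
    where
    a∈Eb : a ∈ E T b
    a∈Eb = E-sym T b∈Ea
    alternate : ∀ {x y} → x ≡ a ⊎ x ≡ b → Star (λ u w → w ∈ E T u) x y → y ≡ a ⊎ y ≡ b
    alternate x∈ab ε = x∈ab
    alternate (inj₁ refl) (step ◅ walk) = alternate (inj₂ (sole-neighbour a∈V b∈Ea step)) walk
    alternate (inj₂ refl) (step ◅ walk) = alternate (inj₁ (sole-neighbour (E⊆V T a∈Eb) a∈Eb step)) walk

  all-leaves⇒≤2 : ∣ V T ∣ ≤ 2
  all-leaves⇒≤2 = decidable-stable (∣ V T ∣ ≤? 2) λ ∣V∣≰2 →
    let a , a∈V = nonempty-of-size (V T) (≤-trans (s≤s z≤n) (≰⇒> ∣V∣≰2))
        b , b∈Ea = nonempty-of-size (E T a) (≤-reflexive (≡-sym (leaf a∈V)))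
    in  ∣V∣≰2 (pair-bound (V T) a b (confined-to-edge a∈V b∈Ea))

-- If |S| ≥ 3, every pedant S-Steiner tree has a vertex outside S: otherwise
-- all its vertices would be leaves, so |S| ≤ |V(T)| ≤ 2.
inner-vertex : ∀ {n} {G : Graph n} (S : Subset n) (T : Subgraph G) → 3 ≤ ∣ S ∣ →
  IsPedantSteinerTree G S T → Σ (Fin n) λ w → w ∈ V T × w ∉ S
inner-vertex S T 3≤∣S∣ ((connected , _) , S⊆V , S-leaves)
  with any? (λ w → (w ∈? V T) ×-dec ¬? (w ∈? S))
... | yes inner  = inner
... | no  ¬inner = ⊥-elim (<⇒≱ 3≤∣S∣ (≤-trans (p⊆q⇒∣p∣≤∣q∣ S⊆V) (all-leaves⇒≤2 T connected V-leaves)))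
  where
  V-leaves : ∀ {v} → v ∈ V T → deg T v ≡ 1
  V-leaves {v} v∈V = S-leaves (decidable-stable (v ∈? S) λ v∉S → ¬inner (v , v∈V , v∉S))

-- A family of t internally disjoint pedant S-Steiner trees has t ≤ n - |S|:
-- inner vertices chosen in distinct trees are distinct vertices outside S.
family-bound : ∀ {n} {G : Graph n} {S : Subset n} {t} → 3 ≤ ∣ S ∣ →
  HasFamily G S t → t ≤ n ∸ ∣ S ∣
family-bound {n} {S = S} {t} 3≤∣S∣ (F , pedant , disjoint) =
  subst (t ≤_) (∣∁p∣≡n∸∣p∣ S) (injection-bound (∁ S) w w-injective (λ i → x∉p⇒x∈∁p (w∉S i)))
  where
  inner : ∀ i → Σ (Fin n) λ w → w ∈ V (F i) × w ∉ S
  inner i = inner-vertex S (F i) 3≤∣S∣ (pedant i)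
  w : Fin t → Fin n
  w i = proj₁ (inner i)
  w∈V : ∀ i → w i ∈ V (F i)
  w∈V i = proj₁ (proj₂ (inner i))
  w∉S : ∀ i → w i ∉ S
  w∉S i = proj₂ (proj₂ (inner i))
  w-injective : Injective _≡_ _≡_ w
  w-injective {i} {j} wi≡wj with i ≟ j
  ... | yes i≡j = i≡j
  ... | no  i≢j = ⊥-elim (w∉S j (proj₁ (proj₂ (disjoint i j i≢j)) (subst (_∈ V (F i)) wi≡wj (w∈V i)) (w∈V j)))

proposition1 : (k n : ℕ) → 3 ≤ k → k ≤ n → (G : Graph n) →
    (t : ℕ) → IsTauK G k t → 0 ≤ t × t ≤ n ∸ k
proposition1 k n 3≤k _ G t (disconnected⇒0 , connected⇒min) = z≤n , upper
  where
  connected-bound : Connected G → t ≤ n ∸ k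
  connected-bound c with connected⇒min c
  ... | (S , refl , family , _) , _ = family-bound 3≤k family
  -- if the bound failed, G would be disconnected, whence t = 0
  upper : t ≤ n ∸ k
  upper = decidable-stable (t ≤? n ∸ k) λ t≰ →
    t≰ (subst (_≤ n ∸ k) (≡-sym (disconnected⇒0 (λ c → t≰ (connected-bound c)))) z≤n)
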